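{- A benzenoid $B$ satisfies $\mathrm{cd}(B)=1$ if and only if its boundary-edges code contains at least one entry $1$ but contains no pair of cyclically consecutive entries equal to $11$, $12$, or $21$.
   Context: A fusene is a simple subcubic $2$-connected plane graph in which all bounded faces are hexagons and all vertices not on the outer face have degree $3$. A benzenoid is a fusene that is a subgraph of the infinite hexagonal lattice. The boundary-edges code of a benzenoid is obtained by traversing the perimeter and recording, for each pair of successive degree-$3$ vertices on the perimeter, the number of boundary edges between them (lexicographically maximal over starting vertex and direction; benzene has code $6$); it is regarded cyclically. A benzenoid $B$ with code $c$ is $k$-convex ($k\ge 0$) if every block of $k+1$ cyclically consecutive entries of $c$ has average at least $2$; the convexity deficit $\mathrm{cd}(B)$ is the minimum $k\ge 0$ for which $B$ is $k$-convex. Benzenoids with $\mathrm{cd}(B)=1$ are called quasi-convex. -}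

module Defs where

open import Data.Nat using (ℕ; zero; suc; _+_; _*_; _≤_; _<_; _%_)
open import Data.Nat.Properties using (_≤?_)
open import Data.Integer as ℤ using (ℤ)
open import Data.Fin using (Fin; zero; suc)
open import Data.Bool using (Bool; true; false; _∧_; if_then_else_)
open import Data.Product using (_×_; _,_)
open import Data.List using (List; []; _∷_; map; _++_; take; drop; length; upTo; reverse; foldr; filter; concatMap)
open import Data.List.Relation.Unary.Unique.Propositional using (Unique)
open import Relation.Binary.PropositionalEquality using (_≡_)
open import Relation.Nullary using (¬_; does)

-- Edge directions are multiples of 60°, numbered
-- 0..5 counterclockwise.  Points are written in the integer basis
-- (1, ω) with ω = e^{iπ/3}.  A walk that turns by ±60° at every
-- vertex stays on a (translate of the) honeycomb lattice.

Point : Set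
Point = ℤ × ℤ

origin : Point
origin = (ℤ.+ 0 , ℤ.+ 0)

unitVec : Fin 6 → Point
unitVec zero                         = (ℤ.+ 1 , ℤ.+ 0)
unitVec (suc zero)                   = (ℤ.+ 0 , ℤ.+ 1)
unitVec (suc (suc zero))             = (ℤ.- ℤ.+ 1 , ℤ.+ 1)
unitVec (suc (suc (suc zero)))       = (ℤ.- ℤ.+ 1 , ℤ.+ 0)
unitVec (suc (suc (suc (suc zero)))) = (ℤ.+ 0 , ℤ.- ℤ.+ 1)
unitVec (suc (suc (suc (suc (suc zero))))) = (ℤ.+ 1 , ℤ.- ℤ.+ 1)

_⊕_ : Point → Point → Point
(a , b) ⊕ (c , d) = (a ℤ.+ c , b ℤ.+ d)

data Turn : Set where
  L R : Turn

rotL : Fin 6 → Fin 6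
rotL zero                         = suc zero
rotL (suc zero)                   = suc (suc zero)
rotL (suc (suc zero))             = suc (suc (suc zero))
rotL (suc (suc (suc zero)))       = suc (suc (suc (suc zero)))
rotL (suc (suc (suc (suc zero)))) = suc (suc (suc (suc (suc zero))))
rotL (suc (suc (suc (suc (suc zero))))) = zero

rotR : Fin 6 → Fin 6
rotR zero                         = suc (suc (suc (suc (suc zero))))
rotR (suc zero)                   = zero
rotR (suc (suc zero))             = suc zero
rotR (suc (suc (suc zero)))       = suc (suc zero)
rotR (suc (suc (suc (suc zero)))) = suc (suc (suc zero))
rotR (suc (suc (suc (suc (suc zero))))) = suc (suc (suc (suc zero)))

applyTurn : Turn → Fin 6 → Fin 6
applyTurn L = rotL
applyTurn R = rotR

-- The walk: edge i leaves vertex v_i in direction d_i; at v_{i+1} the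
-- turn t_i yields d_{i+1}.  'verts' lists v_0 … v_{n-1}; 'endPoint' is v_n.
verts : Fin 6 → Point → List Turn → List Point
verts d p []       = []
verts d p (t ∷ ts) = p ∷ verts (applyTurn t d) (p ⊕ unitVec d) ts

endPoint : Fin 6 → Point → List Turn → Point
endPoint d p []       = p
endPoint d p (t ∷ ts) = endPoint (applyTurn t d) (p ⊕ unitVec d) ts

isL isR : Turn → Bool
isL L = true
isL R = false
isR R = true
isR L = false

countL countR : List Turn → ℕ
countL []       = 0
countL (L ∷ ts) = suc (countL ts)
countL (R ∷ ts) = countL ts
countR []       = 0
countR (R ∷ ts) = suc (countR ts)
countR (L ∷ ts) = countR ts

-- A benzenoid, given by its perimeter: a simple closed walk in the
-- hexagonal lattice traversed counterclockwise (interior on the left),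
-- recorded by its turn sequence.  The benzenoid is the subgraph of the
-- lattice consisting of this cycle and everything inside it.  Perimeter
-- vertices of degree 2 are exactly the left turns, those of degree 3
-- exactly the right turns.

record Benzenoid : Set where
  field
    turns  : List Turn
    closed : endPoint zero origin turns ≡ origin
    simple : Unique (verts zero origin turns)
    ccw    : countL turns ≡ countR turns + 6

-- For a turn list ending with R: lengths (in edges) of the stretches
-- between successive R-vertices.
gaps : List Turn → ℕ → List ℕ
gaps []       acc = []
gaps (L ∷ ts) acc = gaps ts (suc acc)
gaps (R ∷ ts) acc = suc acc ∷ gaps ts 0

endsWithR : List Turn → Bool
endsWithR []       = false
endsWithR (t ∷ []) = isR t
endsWithR (_ ∷ ts) = endsWithR ts

rotations : {A : Set} → List A → List (List A)
rotations xs = map (λ i → drop i xs ++ take i xs) (upTo (length xs))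

lexGe : List ℕ → List ℕ → Bool
lexGe []       _        = true
lexGe (_ ∷ _)  []       = true
lexGe (x ∷ xs) (y ∷ ys) with does (y ≤? x) | does (x ≤? y)
... | true  | true  = lexGe xs ys
... | true  | false = true
... | false | _     = false

lexMax : List (List ℕ) → List ℕ
lexMax = foldr (λ a b → if lexGe a b then a else b) []

-- all codes obtained from some starting degree-3 vertex and either direction
candidateCodes : List Turn → List (List ℕ)
candidateCodes ts =
  let fwd = map (λ r → gaps r 0) (filter (λ r → Data.Bool.T? (endsWithR r)) (rotations ts))
  in fwd ++ map reverse fwd

codeOfTurns : List Turn → List ℕ
codeOfTurns ts with countR ts
... | zero  = 6 ∷ []
... | suc _ = lexMax (candidateCodes ts)

code : Benzenoid → List ℕ
code B = codeOfTurns (Benzenoid.turns B)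

nth : List ℕ → ℕ → ℕ
nth []       _       = 0
nth (x ∷ xs) zero    = x
nth (x ∷ xs) (suc i) = nth xs i

cyc : List ℕ → ℕ → ℕ
cyc []         i = 0
cyc c@(_ ∷ xs) i = nth c (i % suc (length xs))

blockSum : List ℕ → ℕ → ℕ → ℕ
blockSum c i zero    = 0
blockSum c i (suc n) = cyc c i + blockSum c (suc i) n

KConvex : ℕ → List ℕ → Set
KConvex k c = ∀ i → i < length c → 2 * suc k ≤ blockSum c i (suc k)

ConvexityDeficit : List ℕ → ℕ → Set
ConvexityDeficit c d = KConvex d c × (∀ k → k < d → ¬ KConvex k c)

data BadPair : ℕ → ℕ → Set where
  p11 : BadPair 1 1
  p12 : BadPair 1 2
  p21 : BadPair 2 1

{-# OPTIONS --safe #-}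
module Submission where

-- Every entry of a boundary-edges code is positive, since it counts at least one edge.  For a
-- list of positive numbers, 0-convexity says that no entry is 1, and 1-convexity says that no
-- two cyclically consecutive entries sum to less than 4, i.e. form one of the pairs 11, 12, 21.

open import Defs
open import Data.Nat using (ℕ; zero; suc; _<_; _≤_; _+_; z≤n; s≤s; z<s)
open import Data.Nat.Properties using (+-identityʳ; +-mono-≤; <⇒≱; ≮⇒≥; m<n⇒0<n)
open import Data.Nat.DivMod using (m%n<n; m<n⇒m%n≡m)
open import Data.Product using (_×_; ∃; _,_)
open import Data.Product.Function.NonDependent.Propositional using (_×-⇔_)
open import Data.List using (List; []; _∷_; length; map; reverse; filter)
open import Data.List.Relation.Unary.All as All using (All; []; _∷_)
open import Data.List.Relation.Unary.All.Properties using (map⁺; ++⁺)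
open import Data.List.Relation.Unary.Any using (here; there)
open import Data.List.Relation.Unary.Any.Properties using (reverse⁻)
open import Data.List.Membership.Propositional using (_∈_)
open import Data.Bool using (true; false; T?)
open import Data.Empty using (⊥-elim)
open import Function using (_∘_)
open import Function.Bundles using (_⇔_; mk⇔; Equivalence)
open import Function.Construct.Composition using (_⇔-∘_)
open import Relation.Nullary using (¬_; contradiction)
open import Relation.Binary.PropositionalEquality using (_≡_; refl; subst; trans)

private
  variable
    P : List ℕ → Set
    a b x i : ℕ
    c : List ℕ

gaps-positive : ∀ ts acc → All (0 <_) (gaps ts acc)
gaps-positive []       acc = []
gaps-positive (L ∷ ts) acc = gaps-positive ts (suc acc)
gaps-positive (R ∷ ts) acc = z<s ∷ gaps-positive ts 0

All-reverse⁺ : {A : Set} {Q : A → Set} {xs : List A} → All Q xs → All Q (reverse xs)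
All-reverse⁺ qs = All.tabulate (All.lookup qs ∘ reverse⁻)

lexMax-preserves : P [] → {rs : List (List ℕ)} → All P rs → P (lexMax rs)
lexMax-preserves p[] []                  = p[]
lexMax-preserves p[] {r ∷ rs} (pr ∷ prs) with lexGe r (lexMax rs)
... | true  = pr
... | false = lexMax-preserves p[] prs

codeOfTurns-positive : ∀ ts → All (0 <_) (codeOfTurns ts)
codeOfTurns-positive ts with countR ts
... | zero  = z<s ∷ []
... | suc _ = lexMax-preserves [] (++⁺ forward (map⁺ (All.map All-reverse⁺ forward)))
  where
  starts : List (List Turn)
  starts = filter (T? ∘ endsWithR) (rotations ts)
  forward : All (All (0 <_)) (map (λ r → gaps r 0) starts)
  forward = map⁺ (All.universal (λ r → gaps-positive r 0) starts)

code-positive : (B : Benzenoid) → All (0 <_) (code B)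
code-positive B = codeOfTurns-positive (Benzenoid.turns B)

nth∈ : i < length c → nth c i ∈ c
nth∈ {zero}  {_ ∷ _} _         = here refl
nth∈ {suc i} {_ ∷ _} (s≤s i<n) = there (nth∈ i<n)

cyc∈ : ∀ i → 0 < length c → cyc c i ∈ c
cyc∈ {_ ∷ xs} i _ = nth∈ (m%n<n i (suc (length xs)))

cyc≡nth : i < length c → cyc c i ≡ nth c i
cyc≡nth {c = _ ∷ _} i<n rewrite m<n⇒m%n≡m i<n = refl

∈⇒nth : x ∈ c → ∃ λ i → i < length c × nth c i ≡ x
∈⇒nth (here refl) = 0 , z<s , refl
∈⇒nth (there x∈c) with i , i<n , nth≡x ← ∈⇒nth x∈c = suc i , s≤s i<n , nth≡x

∈⇒cyc : x ∈ c → ∃ λ i → i < length c × cyc c i ≡ x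
∈⇒cyc {c = c} x∈c with i , i<n , nth≡x ← ∈⇒nth x∈c = i , i<n , trans (cyc≡nth {c = c} i<n) nth≡x

KConvex0⇔All≥2 : KConvex 0 c ⇔ All (2 ≤_) c
KConvex0⇔All≥2 {c} = mk⇔ to from
  where
  to : KConvex 0 c → All (2 ≤_) c
  to convex = All.tabulate λ x∈c →
    let i , i<n , cyc≡x = ∈⇒cyc x∈c
    in subst (2 ≤_) (trans (+-identityʳ (cyc c i)) cyc≡x) (convex i i<n)
  from : All (2 ≤_) c → KConvex 0 c
  from all≥2 i i<n rewrite +-identityʳ (cyc c i) = All.lookup all≥2 (cyc∈ i (m<n⇒0<n i<n))

¬All≥2⇔1∈ : All (0 <_) c → (¬ All (2 ≤_) c) ⇔ 1 ∈ c
¬All≥2⇔1∈ pos = mk⇔ (to pos) λ 1∈c all≥2 → contradiction (All.lookup all≥2 1∈c) λ { (s≤s ()) }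
  where
  to : All (0 <_) c → ¬ All (2 ≤_) c → 1 ∈ c
  to []                          ¬all = ⊥-elim (¬all [])
  to {1 ∷ _}           (_ ∷ _)   _    = here refl
  to {suc (suc _) ∷ _} (_ ∷ pos) ¬all = there (to pos (¬all ∘ (s≤s (s≤s z≤n) ∷_)))

¬KConvex0⇔1∈ : All (0 <_) c → (¬ KConvex 0 c) ⇔ 1 ∈ c
¬KConvex0⇔1∈ pos = ¬All≥2⇔1∈ pos ⇔-∘ mk⇔ (_∘ Equivalence.from KConvex0⇔All≥2) (_∘ Equivalence.to KConvex0⇔All≥2)

BadPair⇒sum<4 : BadPair a b → a + b < 4
BadPair⇒sum<4 p11 = s≤s (s≤s (s≤s z≤n))
BadPair⇒sum<4 p12 = s≤s (s≤s (s≤s (s≤s z≤n)))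
BadPair⇒sum<4 p21 = s≤s (s≤s (s≤s (s≤s z≤n)))

sum<4⇒BadPair : 0 < a → 0 < b → a + b < 4 → BadPair a b
sum<4⇒BadPair {1}                 {1}                 _ _ _ = p11
sum<4⇒BadPair {1}                 {2}                 _ _ _ = p12
sum<4⇒BadPair {2}                 {1}                 _ _ _ = p21
sum<4⇒BadPair {1}                 {suc (suc (suc _))} _ _ (s≤s (s≤s (s≤s (s≤s ()))))
sum<4⇒BadPair {2}                 {suc (suc _)}       _ _ (s≤s (s≤s (s≤s (s≤s ()))))
sum<4⇒BadPair {suc (suc (suc _))} {suc _}             _ _ sum<4 =
  contradiction (+-mono-≤ (s≤s (s≤s (s≤s z≤n))) z<s) (<⇒≱ sum<4)

HasBadPair : List ℕ → Set
HasBadPair c = ∃ λ i → i < length c × BadPair (cyc c i) (cyc c (suc i))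

KConvex1⇔¬HasBadPair : All (0 <_) c → KConvex 1 c ⇔ (¬ HasBadPair c)
KConvex1⇔¬HasBadPair {c} pos = mk⇔ to from
  where
  to : KConvex 1 c → ¬ HasBadPair c
  to convex (i , i<n , bad) with convex i i<n
  ... | 4≤sum rewrite +-identityʳ (cyc c (suc i)) = <⇒≱ (BadPair⇒sum<4 bad) 4≤sum
  from : ¬ HasBadPair c → KConvex 1 c
  from noBad i i<n rewrite +-identityʳ (cyc c (suc i)) =
    ≮⇒≥ λ sum<4 → noBad (i , i<n , sum<4⇒BadPair (entry i) (entry (suc i)) sum<4)
    where
    entry : ∀ j → 0 < cyc c j
    entry j = All.lookup pos (cyc∈ j (m<n⇒0<n i<n))

ConvexityDeficit1⇔ : ConvexityDeficit c 1 ⇔ (¬ KConvex 0 c × KConvex 1 c)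
ConvexityDeficit1⇔ = mk⇔ (λ (convex , minimal) → minimal 0 z<s , convex)
                         (λ (¬convex₀ , convex) → convex , λ { zero _ → ¬convex₀ ; (suc _) (s≤s ()) })

mainTheorem4 : (B : Benzenoid) →
    ConvexityDeficit (code B) 1 ⇔
      (1 ∈ code B × ¬ (∃ λ i → i < length (code B) × BadPair (cyc (code B) i) (cyc (code B) (suc i))))
mainTheorem4 B = (¬KConvex0⇔1∈ pos ×-⇔ KConvex1⇔¬HasBadPair pos) ⇔-∘ ConvexityDeficit1⇔
  where
  pos : All (0 <_) (code B)
  pos = code-positive B
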